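{- Let $r>0$ be rational, let $q\geq 2$ be an integer, and let $h\geq 1$ and $m\geq 3$ be integers with $\gcd(h,m)=1$ and $\frac{h}{m}<\frac12$. Then there exists $u\in\mathbb{N}$ such that \[ \frac{s_q\left(\lfloor u^{h/m}\rfloor\right)}{s_q(u)}=r. \]
   Context: For an integer $q\geq 2$ and $n\in\mathbb{N}$, $s_q(n)$ denotes the sum of the digits of $n$ written in base $q$. $\lfloor x\rfloor$ is the floor of $x$. -}

module Defs where

open import Data.Nat using (ℕ; zero; suc; _+_; _*_; _^_; _≤ᵇ_; _/_; _%_; _<_)
open import Data.Bool using (if_then_else_)
open import Data.Nat.Induction using (<-wellFounded)
open import Induction.WellFounded using (Acc; acc)
open import Data.Nat.DivMod using (m/n<m)
open import Data.Nat.Properties using (≤-refl)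

-- base-q digit sum, with fuel argument (fuel ≥ n suffices since n / q < n for q ≥ 2)
digitSumAux : ℕ → ℕ → ℕ → ℕ
digitSumAux q zero    n = 0
digitSumAux q (suc f) zero = 0
digitSumAux q (suc f) n@(suc _) = n % suc (suc q) + digitSumAux q f (n / suc (suc q))

-- s_q(n) for q = b + 2 (so every base q ≥ 2 is covered)
-- we expose s for a base q given as q ≥ 2 via the wrapper below
digitSum₂ : ℕ → ℕ → ℕ
digitSum₂ b n = digitSumAux b n n

-- s q n : sum of base-q digits of n, for q ≥ 2; (for q < 2 the value is irrelevant, returns 0)
s : ℕ → ℕ → ℕ
s zero n = 0
s (suc zero) n = 0
s (suc (suc b)) n = digitSum₂ b n

rootAux : ℕ → ℕ → ℕ → ℕ
rootAux m x zero = 0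
rootAux m x (suc k) = if (suc k ^ m ≤ᵇ x) then suc k else rootAux m x k

iroot : ℕ → ℕ → ℕ
iroot m x = rootAux m x x

-- ⌊ u ^ (h / m) ⌋ = ⌊ (u ^ h) ^ (1/m) ⌋
floorPow : ℕ → ℕ → ℕ → ℕ
floorPow u h m = iroot m (u ^ h)

module Submission where

-- Theorem 4.1: for rational r > 0, base q ≥ 2 and 2h < m there is u with
-- s_q(⌊u^{h/m}⌋) = r · s_q(u).
--
-- Write q = b + 2, r = A/B, m = h + p with p > h.  For a large power x = q^N
-- put y = x^h, choose T, D with D + 1 = hT and set
--     u = x^p (y + mT) + w .
-- Then u^{h/m} ≈ y + hT − (small), and the bracketing
--     (y + D)^m ≤ u^h < (y + D + 1)^m
-- shows ⌊u^{h/m}⌋ = y + D.  Since all summands of u and y + D occupy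
-- disjoint blocks of base-q digits, their digit sums add up; taking D a
-- block of maximal digits, T a multiple of q^K and w a repunit, the digit
-- sums s(y + D) and s(u) can be tuned (through K and the repunit length)
-- to be in the ratio A : B.

open import Data.Nat using (ℕ)

module PowerBounds where
  open import Data.Nat
  open import Data.Nat.Properties
  open import Relation.Binary.PropositionalEquality
  open import Data.Nat.Tactic.RingSolver
  open ≤-Reasoning

  bernoulli-upper : ∀ A D n → (A + D) ^ suc n ≤ A ^ suc n + suc n * D * (A + D) ^ n
  bernoulli-upper A D zero = ≤-reflexive (expand A D)
    where expand : ∀ A D → (A + D) * 1 ≡ A * 1 + 1 * D * 1
          expand = solve-∀
  bernoulli-upper A D (suc n) =
    begin
      (A + D) * R
    ≤⟨ *-monoʳ-≤ (A + D) (bernoulli-upper A D n) ⟩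
      (A + D) * (Aⁿ⁺¹ + suc n * D * P)
    ≡⟨ expand A D Aⁿ⁺¹ P n ⟩
      A * Aⁿ⁺¹ + D * Aⁿ⁺¹ + suc n * D * ((A + D) * P)
    ≤⟨ +-monoˡ-≤ (suc n * D * ((A + D) * P)) (+-monoʳ-≤ (A * Aⁿ⁺¹) (*-monoʳ-≤ D (^-monoˡ-≤ (suc n) (m≤m+n A D)))) ⟩
      A * Aⁿ⁺¹ + D * R + suc n * D * R
    ≡⟨ collect A D Aⁿ⁺¹ R n ⟩
      A * Aⁿ⁺¹ + suc (suc n) * D * R
    ∎
    where
      P = (A + D) ^ n
      Aⁿ⁺¹ = A ^ suc n
      R = (A + D) ^ suc n
      expand : ∀ A D Aⁿ⁺¹ P n → (A + D) * (Aⁿ⁺¹ + suc n * D * P) ≡ A * Aⁿ⁺¹ + D * Aⁿ⁺¹ + suc n * D * ((A + D) * P)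
      expand = solve-∀
      collect : ∀ A D Aⁿ⁺¹ R n → A * Aⁿ⁺¹ + D * R + suc n * D * R ≡ A * Aⁿ⁺¹ + suc (suc n) * D * R
      collect = solve-∀

  bernoulli-lower : ∀ A D n → A ^ suc n + suc n * D * A ^ n ≤ (A + D) ^ suc n
  bernoulli-lower A D zero = ≤-reflexive (expand A D)
    where expand : ∀ A D → A * 1 + 1 * D * 1 ≡ (A + D) * 1
          expand = solve-∀
  bernoulli-lower A D (suc n) =
    begin
      A * (A * Aⁿ) + suc (suc n) * D * (A * Aⁿ)
    ≤⟨ m≤m+n _ (suc n * D * D * Aⁿ) ⟩
      A * (A * Aⁿ) + suc (suc n) * D * (A * Aⁿ) + suc n * D * D * Aⁿ
    ≡⟨ factor A D Aⁿ n ⟩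
      (A + D) * (A * Aⁿ + suc n * D * Aⁿ)
    ≤⟨ *-monoʳ-≤ (A + D) (bernoulli-lower A D n) ⟩
      (A + D) * (A + D) ^ suc n
    ∎
    where
      Aⁿ = A ^ n
      factor : ∀ A D Aⁿ n → A * (A * Aⁿ) + suc (suc n) * D * (A * Aⁿ) + suc n * D * D * Aⁿ ≡ (A + D) * (A * Aⁿ + suc n * D * Aⁿ)
      factor = solve-∀

  -- With A = B + hT:  B (A + T)^h + h T² (A + T)^(h-1) ≤ A^(h+1).
  -- (Add hTA(A+T)^(h-1) to both sides; the left side becomes A (A+T)^h.)
  power-gap : ∀ B T h₁ → B * (B + suc h₁ * T + T) ^ suc h₁ + suc h₁ * T * T * (B + suc h₁ * T + T) ^ h₁
                         ≤ (B + suc h₁ * T) ^ suc (suc h₁)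
  power-gap B T h₁ = +-cancelʳ-≤ (h * T * A * P) _ _ (
    begin
      B * ((A + T) * P) + h * T * T * P + h * T * A * P
    ≡⟨ regroup B T P h ⟩
      A * ((A + T) * P)
    ≤⟨ *-monoʳ-≤ A (bernoulli-upper A T h₁) ⟩
      A * (A ^ h + h * T * P)
    ≡⟨ distribute A T P (A ^ h) h ⟩
      A * A ^ h + h * T * A * P
    ∎)
    where
      h = suc h₁
      A = B + h * T
      P = (A + T) ^ h₁
      regroup : ∀ B T P h → B * ((B + h * T + T) * P) + h * T * T * P + h * T * (B + h * T) * P
                            ≡ (B + h * T) * ((B + h * T + T) * P)
      regroup = solve-∀
      distribute : ∀ A T P Aʰ h → A * (Aʰ + h * T * P) ≡ A * Aʰ + h * T * A * P
      distribute = solve-∀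

  -- One step of the comparison below: for y ≥ 1 and A = y + dT + hT,
  --   y (A + T)^h ≤ (y + hT) A^h.
  -- Multiply by B = y + dT (so A = B + hT), use power-gap, and cancel B.
  ratio-step : ∀ y T h₁ d → 1 ≤ y →
    y * (y + d * T + suc h₁ * T + T) ^ suc h₁ ≤ (y + suc h₁ * T) * (y + d * T + suc h₁ * T) ^ suc h₁
  ratio-step y T h₁ d 1≤y = *-cancelˡ-≤ B {{>-nonZero (≤-trans 1≤y (m≤m+n y (d * T)))}} (
    begin
      B * (y * (A + T) ^ h)
    ≡⟨ swap B y ((A + T) ^ h) ⟩
      y * (B * (A + T) ^ h)
    ≤⟨ *-monoʳ-≤ y (≤-trans (m≤m+n _ _) (power-gap B T h₁)) ⟩
      y * (A * A ^ h)
    ≡⟨ *-assoc y A (A ^ h) ⟨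
      (y * A) * A ^ h
    ≤⟨ *-monoˡ-≤ (A ^ h) (m≤m+n (y * A) (h * T * (d * T))) ⟩
      (y * A + h * T * (d * T)) * A ^ h
    ≡⟨ cong (_* A ^ h) (factor y (h * T) (d * T)) ⟩
      ((y + h * T) * B) * A ^ h
    ≡⟨ rotate (y + h * T) B (A ^ h) ⟩
      B * ((y + h * T) * A ^ h)
    ∎)
    where
      h = suc h₁
      B = y + d * T
      A = B + h * T
      swap : ∀ B y Z → B * (y * Z) ≡ y * (B * Z)
      swap = solve-∀
      factor : ∀ y hT dT → y * (y + dT + hT) + hT * dT ≡ (y + hT) * (y + dT)
      factor = solve-∀
      rotate : ∀ a B Z → (a * B) * Z ≡ B * (a * Z)
      rotate = solve-∀

  -- Induction on p: the base case is
  -- power-gap, each further factor y is traded for (y + hT) by ratio-step.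
  power-comparison : ∀ y T h₁ p → 1 ≤ y →
    y ^ suc p * (y + (suc h₁ + suc p) * T) ^ suc h₁ + suc h₁ * T * T * y ^ h₁ * y ^ p
      ≤ (y + suc h₁ * T) ^ (suc h₁ + suc p)
  power-comparison y T h₁ zero 1≤y =
    begin
      y * 1 * (y + (h + 1) * T) ^ h + h * T * T * y ^ h₁ * 1
    ≡⟨ cong (λ a → y * 1 * a ^ h + h * T * T * y ^ h₁ * 1) (split-last y T h) ⟩
      y * 1 * (y + h * T + T) ^ h + h * T * T * y ^ h₁ * 1
    ≡⟨ drop-units y ((y + h * T + T) ^ h) (y ^ h₁) h T ⟩
      y * (y + h * T + T) ^ h + h * T * T * y ^ h₁
    ≤⟨ +-monoʳ-≤ (y * (y + h * T + T) ^ h) (*-monoʳ-≤ (h * T * T) (^-monoˡ-≤ h₁ (≤-trans (m≤m+n y (h * T)) (m≤m+n _ T)))) ⟩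
      y * (y + h * T + T) ^ h + h * T * T * (y + h * T + T) ^ h₁
    ≤⟨ power-gap y T h₁ ⟩
      (y + h * T) ^ suc h
    ≡⟨ cong ((y + h * T) ^_) (+-comm 1 h) ⟩
      (y + h * T) ^ (h + 1)
    ∎
    where
      h = suc h₁
      split-last : ∀ y T h → y + (h + 1) * T ≡ y + h * T + T
      split-last = solve-∀
      drop-units : ∀ y Zʰ Y h T → y * 1 * Zʰ + h * T * T * Y * 1 ≡ y * Zʰ + h * T * T * Y
      drop-units = solve-∀
  power-comparison y T h₁ (suc p) 1≤y =
    begin
      y * (y * yᵖ) * (y + (h + suc (suc p)) * T) ^ h + G * (y * yᵖ)
    ≡⟨ cong (λ z → y * (y * yᵖ) * z ^ h + G * (y * yᵖ)) (split-last y T h p) ⟩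
      y * (y * yᵖ) * (A + T) ^ h + G * (y * yᵖ)
    ≡⟨ regroup y yᵖ ((A + T) ^ h) G ⟩
      (y * yᵖ) * (y * (A + T) ^ h) + y * (G * yᵖ)
    ≤⟨ +-mono-≤ (*-monoʳ-≤ (y * yᵖ) step) (*-monoˡ-≤ (G * yᵖ) (m≤m+n y (h * T))) ⟩
      (y * yᵖ) * ((y + h * T) * A ^ h) + (y + h * T) * (G * yᵖ)
    ≡⟨ factor (y * yᵖ) (y + h * T) (A ^ h) (G * yᵖ) ⟩
      (y + h * T) * ((y * yᵖ) * A ^ h + G * yᵖ)
    ≤⟨ *-monoʳ-≤ (y + h * T) (power-comparison y T h₁ p 1≤y) ⟩
      (y + h * T) * (y + h * T) ^ (h + suc p)
    ≡⟨ cong ((y + h * T) ^_) (+-suc h (suc p)) ⟨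
      (y + h * T) ^ (h + suc (suc p))
    ∎
    where
      h = suc h₁
      yᵖ = y ^ p
      G = h * T * T * y ^ h₁
      A = y + (h + suc p) * T
      split-last : ∀ y T h p → y + (h + suc (suc p)) * T ≡ y + (h + suc p) * T + T
      split-last = solve-∀
      regroup : ∀ y yᵖ Z G → y * (y * yᵖ) * Z + G * (y * yᵖ) ≡ (y * yᵖ) * (y * Z) + y * (G * yᵖ)
      regroup = solve-∀
      factor : ∀ a b c d → a * (b * c) + b * d ≡ b * (a * c + d)
      factor = solve-∀
      reorder : ∀ y T h p → y + suc p * T + h * T ≡ y + (h + suc p) * T
      reorder = solve-∀
      step : y * (A + T) ^ h ≤ (y + h * T) * A ^ h
      step = subst (λ a → y * (a + T) ^ h ≤ (y + h * T) * a ^ h) (reorder y T h p) (ratio-step y T h₁ (suc p) 1≤y)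

  pow-of-product : ∀ a b k → (a * b) ^ k ≡ a ^ k * b ^ k
  pow-of-product a b zero = refl
  pow-of-product a b (suc k) rewrite pow-of-product a b k = interchange a b (a ^ k) (b ^ k)
    where interchange : ∀ a b c d → a * b * (c * d) ≡ a * c * (b * d)
          interchange = solve-∀

  pow-pow-comm : ∀ x a b → (x ^ a) ^ b ≡ (x ^ b) ^ a
  pow-pow-comm x a b = trans (^-*-assoc x a b) (trans (cong (x ^_) (*-comm a b)) (sym (^-*-assoc x b a)))

  pos-pow : ∀ x n → 1 ≤ x → 1 ≤ x ^ n
  pos-pow x zero _ = ≤-refl
  pos-pow x (suc n) 1≤x = *-mono-≤ 1≤x (pos-pow x n 1≤x)

  bernoulli-upper₂ : ∀ A D k → (A + D) ^ (2 + k)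
    ≤ A ^ (2 + k) + (2 + k) * D * A ^ (1 + k) + (2 + k) * (1 + k) * D * D * (A + D) ^ k
  bernoulli-upper₂ A D k =
    begin
      (A + D) ^ (2 + k)
    ≤⟨ bernoulli-upper A D (1 + k) ⟩
      A ^ (2 + k) + (2 + k) * D * (A + D) ^ (1 + k)
    ≤⟨ +-monoʳ-≤ (A ^ (2 + k)) (*-monoʳ-≤ ((2 + k) * D) (bernoulli-upper A D k)) ⟩
      A ^ (2 + k) + (2 + k) * D * (A ^ (1 + k) + (1 + k) * D * (A + D) ^ k)
    ≡⟨ expand (A ^ (2 + k)) (A ^ (1 + k)) ((A + D) ^ k) D k ⟩
      A ^ (2 + k) + (2 + k) * D * A ^ (1 + k) + (2 + k) * (1 + k) * D * D * (A + D) ^ k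
    ∎
    where
      expand : ∀ a b c D k → a + (2 + k) * D * (b + (1 + k) * D * c) ≡ a + (2 + k) * D * b + (2 + k) * (1 + k) * D * D * c
      expand = solve-∀

  -- If y is large compared with D (namely (k+1) D² 2^k ≤ y and D ≤ y), the
  -- second-order term is absorbed into the linear one:
  --   (y + D)^(k+2) ≤ y^(k+2) + (k+2)(D+1) y^(k+1).
  near-power-upper : ∀ y D k → (1 + k) * D * D * 2 ^ k ≤ y → D ≤ y →
    (y + D) ^ (2 + k) ≤ y ^ (2 + k) + (2 + k) * suc D * y ^ (1 + k)
  near-power-upper y D k big D≤y =
    begin
      (y + D) ^ (2 + k)
    ≤⟨ bernoulli-upper₂ y D k ⟩
      y ^ (2 + k) + (2 + k) * D * y ^ (1 + k) + (2 + k) * (1 + k) * D * D * (y + D) ^ k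
    ≤⟨ +-monoʳ-≤ (y ^ (2 + k) + (2 + k) * D * y ^ (1 + k)) (*-monoʳ-≤ ((2 + k) * (1 + k) * D * D) sum-bound) ⟩
      y ^ (2 + k) + (2 + k) * D * y ^ (1 + k) + (2 + k) * (1 + k) * D * D * (2 ^ k * y ^ k)
    ≡⟨ regroup (y ^ (2 + k)) (y ^ (1 + k)) (y ^ k) D k (2 ^ k) ⟩
      y ^ (2 + k) + (2 + k) * D * y ^ (1 + k) + (2 + k) * ((1 + k) * D * D * 2 ^ k) * y ^ k
    ≤⟨ +-monoʳ-≤ (y ^ (2 + k) + (2 + k) * D * y ^ (1 + k)) (*-monoˡ-≤ (y ^ k) (*-monoʳ-≤ (2 + k) big)) ⟩
      y ^ (2 + k) + (2 + k) * D * y ^ (1 + k) + (2 + k) * y * y ^ k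
    ≡⟨ collect (y ^ (2 + k)) (y ^ k) y D k ⟩
      y ^ (2 + k) + (2 + k) * suc D * y ^ (1 + k)
    ∎
    where
      double : ∀ y → y + y ≡ 2 * y
      double = solve-∀
      sum-bound : (y + D) ^ k ≤ 2 ^ k * y ^ k
      sum-bound = ≤-trans (^-monoˡ-≤ k (+-monoʳ-≤ y D≤y)) (≤-reflexive (trans (cong (_^ k) (double y)) (pow-of-product 2 y k)))
      regroup : ∀ a c yᵏ D k t → a + (2 + k) * D * c + (2 + k) * (1 + k) * D * D * (t * yᵏ)
                                 ≡ a + (2 + k) * D * c + (2 + k) * ((1 + k) * D * D * t) * yᵏ
      regroup = solve-∀
      collect : ∀ a c y D k → a + (2 + k) * D * (y * c) + (2 + k) * y * c ≡ a + (2 + k) * suc D * (y * c)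
      collect = solve-∀

  base≤power : ∀ x n → x ≤ x ^ suc n
  base≤power zero n = z≤n
  base≤power x@(suc _) n = m≤m*n x (x ^ n) {{m^n≢0 x n}}

module IntegerRoot where
  open import Defs
  open import Data.Nat
  open import Data.Nat.Properties
  open import Data.Bool using (true; false; T)
  open import Relation.Binary.PropositionalEquality
  open import Relation.Nullary using (¬_; contradiction)
  open PowerBounds using (base≤power)

  -- The downward scan rootAux m X k returns v whenever v ≤ k and v is the
  -- integer m-th root of X, i.e. v^m ≤ X < (v+1)^m: candidates above v fail
  -- the test, and v itself passes it.
  rootAux-spec : ∀ m X v k → v ≤ k → v ^ m ≤ X → X < suc v ^ m → rootAux m X k ≡ v
  rootAux-spec m X zero zero _ _ _ = refl
  rootAux-spec m X v (suc k) v≤k lo hi with suc k ^ m ≤ᵇ X in test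
  ... | true = ≤-antisym (≮⇒≥ k+1≯v) v≤k
    where
      k+1≯v : ¬ v < suc k
      k+1≯v v<k+1 = contradiction (≤-trans (^-monoˡ-≤ m v<k+1) (≤ᵇ⇒≤ (suc k ^ m) X (subst T (sym test) _))) (<⇒≱ hi)
  ... | false = rootAux-spec m X v k (≤-pred (≤∧≢⇒< v≤k v≢k+1)) lo hi
    where
      v≢k+1 : v ≢ suc k
      v≢k+1 refl with ≤⇒≤ᵇ lo
      ... | passes rewrite test = passes

  floorPow-spec : ∀ u h m v → v ^ suc m ≤ u ^ h → u ^ h < suc v ^ suc m → floorPow u h (suc m) ≡ v
  floorPow-spec u h m v lo hi = rootAux-spec (suc m) (u ^ h) v (u ^ h) (≤-trans (base≤power v m) lo) lo hi

module DigitSums (b : ℕ) where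
  open import Defs
  open import Data.Nat
  open import Data.Nat.Properties
  open import Data.Nat.DivMod
  open import Data.Product using (∃; _,_)
  open import Relation.Binary.PropositionalEquality
  open import Data.Nat.Tactic.RingSolver
  open ≡-Reasoning

  Q : ℕ
  Q = suc (suc b)

  ds : ℕ → ℕ
  ds n = digitSumAux b n n

  1<Q : 1 < Q
  1<Q = s≤s (s≤s z≤n)

  n/Q<n : ∀ n → suc n / Q ≤ n
  n/Q<n n = <⇒≤pred (m/n<m (suc n) Q 1<Q)

  fuel-irrelevant : ∀ f g n → n ≤ f → n ≤ g → digitSumAux b f n ≡ digitSumAux b g n
  fuel-irrelevant zero zero zero _ _ = refl
  fuel-irrelevant zero (suc g) zero _ _ = refl
  fuel-irrelevant (suc f) zero zero _ _ = refl
  fuel-irrelevant (suc f) (suc g) zero _ _ = refl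
  fuel-irrelevant (suc f) (suc g) (suc n) (s≤s n≤f) (s≤s n≤g) =
    cong (suc n % Q +_) (fuel-irrelevant f g (suc n / Q) (≤-trans (n/Q<n n) n≤f) (≤-trans (n/Q<n n) n≤g))

  ds-step : ∀ n → ds n ≡ n % Q + ds (n / Q)
  ds-step zero = refl
  ds-step (suc n) = cong (suc n % Q +_) (fuel-irrelevant n (suc n / Q) (suc n / Q) (n/Q<n n) ≤-refl)

  ds-digit : ∀ d k → d < Q → ds (d + k * Q) ≡ d + ds k
  ds-digit d k d<Q = trans (ds-step (d + k * Q)) (cong₂ _+_ last-digit (cong ds rest))
    where
      last-digit : (d + k * Q) % Q ≡ d
      last-digit = trans ([m+kn]%n≡m%n d k Q) (m<n⇒m%n≡m d<Q)
      no-carry : d % Q + k * Q % Q < Q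
      no-carry = subst (_< Q) (sym (trans (cong₂ _+_ (m<n⇒m%n≡m d<Q) (m*n%n≡0 k Q)) (+-identityʳ d))) d<Q
      rest : (d + k * Q) / Q ≡ k
      rest = trans (+-distrib-/ d (k * Q) no-carry) (cong₂ _+_ (m<n⇒m/n≡0 d<Q) (m*n/n≡m k Q))

  ds-one : ds 1 ≡ 1
  ds-one = ds-digit 1 0 (s≤s (s≤s z≤n))

  ds-concat : ∀ K a c → c < Q ^ K → ds (a * Q ^ K + c) ≡ ds a + ds c
  ds-concat zero a zero _ rewrite *-identityʳ a | +-identityʳ a | +-identityʳ (ds a) = refl
  ds-concat zero a (suc c) (s≤s ())
  ds-concat (suc K) a c c<Q^K+1 =
    begin
      ds (a * (Q * Q ^ K) + c)
    ≡⟨ cong ds split ⟩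
      ds (c % Q + (a * Q ^ K + c / Q) * Q)
    ≡⟨ ds-digit (c % Q) (a * Q ^ K + c / Q) (m%n<n c Q) ⟩
      c % Q + ds (a * Q ^ K + c / Q)
    ≡⟨ cong (c % Q +_) (ds-concat K a (c / Q) (m<n*o⇒m/o<n (subst (c <_) (*-comm Q (Q ^ K)) c<Q^K+1))) ⟩
      c % Q + (ds a + ds (c / Q))
    ≡⟨ +-comm-middle (c % Q) (ds a) (ds (c / Q)) ⟩
      ds a + (c % Q + ds (c / Q))
    ≡⟨ cong (ds a +_) (ds-step c) ⟨
      ds a + ds c
    ∎
    where
      shift-digit : ∀ a Qᴷ Q r d → a * (Q * Qᴷ) + (r + d * Q) ≡ r + (a * Qᴷ + d) * Q
      shift-digit = solve-∀
      split : a * (Q * Q ^ K) + c ≡ c % Q + (a * Q ^ K + c / Q) * Q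
      split = trans (cong (a * (Q * Q ^ K) +_) (m≡m%n+[m/n]*n c Q)) (shift-digit a (Q ^ K) Q (c % Q) (c / Q))
      +-comm-middle : ∀ x y z → x + (y + z) ≡ y + (x + z)
      +-comm-middle = solve-∀

  ds-shift : ∀ K a → ds (a * Q ^ K) ≡ ds a
  ds-shift K a = trans (cong ds (sym (+-identityʳ (a * Q ^ K))))
                       (trans (ds-concat K a 0 (m^n>0 Q K)) (+-identityʳ (ds a)))

  ds-leading-one : ∀ K c → c < Q ^ K → ds (Q ^ K + c) ≡ suc (ds c)
  ds-leading-one K c c<Q^K = trans (cong (λ z → ds (z + c)) (sym (*-identityˡ (Q ^ K))))
                                   (trans (ds-concat K 1 c c<Q^K) (cong (_+ ds c) ds-one))

  maxBlock : ℕ → ℕ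
  maxBlock zero = 0
  maxBlock (suc K) = suc b + maxBlock K * Q

  maxBlock-value : ∀ K → suc (maxBlock K) ≡ Q ^ K
  maxBlock-value zero = refl
  maxBlock-value (suc K) = trans (factor (maxBlock K) b) (cong (Q *_) (maxBlock-value K))
    where factor : ∀ r b → suc (suc b + r * suc (suc b)) ≡ suc (suc b) * suc r
          factor = solve-∀

  maxBlock-ds : ∀ K → ds (maxBlock K) ≡ K * suc b
  maxBlock-ds zero = refl
  maxBlock-ds (suc K) = trans (ds-digit (suc b) (maxBlock K) ≤-refl) (cong (suc b +_) (maxBlock-ds K))

  repunit : ℕ → ℕ
  repunit zero = 0
  repunit (suc W) = 1 + repunit W * Q

  repunit-ds : ∀ W → ds (repunit W) ≡ W
  repunit-ds zero = refl
  repunit-ds (suc W) = trans (ds-digit 1 (repunit W) (s≤s (s≤s z≤n))) (cong suc (repunit-ds W))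

  repunit< : ∀ W → repunit W < Q ^ W
  repunit< zero = s≤s z≤n
  repunit< (suc W) = ≤-trans (≤-trans (m≤m+n (suc (1 + repunit W * Q)) b) (≤-reflexive (factor (repunit W) b))) (*-monoʳ-≤ Q (repunit< W))
    where factor : ∀ o b → suc (1 + o * suc (suc b)) + b ≡ suc (suc b) * suc o
          factor = solve-∀

  -- Casting out (Q − 1)s: ds n ≡ n modulo Q − 1, in the form
  -- ds n + (Q − 1) j = n for some j.  (Induction on a fuel bound f ≥ n.)
  ds-congruence : ∀ n → ∃ λ j → ds n + suc b * j ≡ n
  ds-congruence n = bounded n n ≤-refl
    where
      regroup : ∀ r s b j d → r + s + suc b * (j + d) ≡ r + (s + suc b * j) + suc b * d
      regroup = solve-∀
      collect : ∀ r d b → r + d + suc b * d ≡ r + d * suc (suc b)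
      collect = solve-∀
      bounded : ∀ f n → n ≤ f → ∃ λ j → ds n + suc b * j ≡ n
      bounded f zero _ = 0 , *-zeroʳ (suc b)
      bounded (suc f) (suc n) (s≤s n≤f) with bounded f (suc n / Q) (≤-trans (n/Q<n n) n≤f)
      ... | j , eq = j + suc n / Q ,
        (begin
          ds (suc n) + suc b * (j + suc n / Q)
        ≡⟨ cong (_+ suc b * (j + suc n / Q)) (ds-step (suc n)) ⟩
          suc n % Q + ds (suc n / Q) + suc b * (j + suc n / Q)
        ≡⟨ regroup (suc n % Q) (ds (suc n / Q)) b j (suc n / Q) ⟩
          suc n % Q + (ds (suc n / Q) + suc b * j) + suc b * (suc n / Q)
        ≡⟨ cong (λ z → suc n % Q + z + suc b * (suc n / Q)) eq ⟩
          suc n % Q + suc n / Q + suc b * (suc n / Q)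
        ≡⟨ collect (suc n % Q) (suc n / Q) b ⟩
          suc n % Q + suc n / Q * Q
        ≡⟨ m≡m%n+[m/n]*n (suc n) Q ⟨
          suc n
        ∎)

  n<Q^n : ∀ n → n < Q ^ n
  n<Q^n zero = s≤s z≤n
  n<Q^n (suc n) = ≤-trans (≤-reflexive (+-comm 1 (suc n))) (+-mono-≤ (n<Q^n n) (*-mono-≤ (s≤s (z≤n {b})) (m^n>0 Q n)))

module Bracket (h₁ e x T D w : ℕ) where
  open import Defs using (floorPow)
  open import Data.Nat
  open import Data.Nat.Properties
  open import Relation.Binary.PropositionalEquality
  open import Data.Nat.Tactic.RingSolver
  open PowerBounds
  open IntegerRoot using (floorPow-spec)
  open ≤-Reasoning

  h p m k y u₀ u : ℕ
  h = suc h₁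
  p = suc (h + e)
  m = h + p
  k = h₁ + (h + e)
  y = x ^ h
  u₀ = x ^ p * (y + m * T)
  u = u₀ + w

  m≡k+2 : m ≡ 2 + k
  m≡k+2 = cong suc (+-suc h₁ (h + e))

  u₀^h : u₀ ^ h ≡ y ^ p * (y + m * T) ^ h
  u₀^h = trans (pow-of-product (x ^ p) (y + m * T) h) (cong (_* (y + m * T) ^ h) (pow-pow-comm x p h))

  factor-positive : ∀ n c t → suc n ≡ c * t → 1 ≤ t
  factor-positive n c zero eq with trans eq (*-zeroʳ c)
  ... | ()
  factor-positive n c (suc t) _ = s≤s z≤n

  module _ (1≤x : 1 ≤ x) (hT : suc D ≡ h * T) where

    1≤y : 1 ≤ y
    1≤y = pos-pow x h 1≤x

    -- Lower bound: expand (y + D)^m to first order and compare with the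
    -- Bernoulli lower bound for (y + mT)^h, using m(D + 1) = h · mT.
    lower : (1 + k) * D * D * 2 ^ k ≤ y → D ≤ y → (y + D) ^ m ≤ u ^ h
    lower big D≤y =
      begin
        (y + D) ^ m
      ≡⟨ cong ((y + D) ^_) m≡k+2 ⟩
        (y + D) ^ (2 + k)
      ≤⟨ near-power-upper y D k big D≤y ⟩
        y ^ (2 + k) + (2 + k) * suc D * y ^ (1 + k)
      ≡⟨ cong₂ (λ a c → a + c * suc D * (y ^ (1 + k))) (sym y^m) (sym m≡k+2) ⟩
        y ^ p * y ^ h + m * suc D * y ^ (1 + k)
      ≡⟨ cong₂ (λ a c → y ^ p * y ^ h + m * a * c) hT (sym y^m-1) ⟩
        y ^ p * y ^ h + m * (h * T) * (y ^ p * y ^ h₁)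
      ≡⟨ factor (y ^ p) (y ^ h) (y ^ h₁) m h T ⟩
        y ^ p * (y ^ h + h * (m * T) * y ^ h₁)
      ≤⟨ *-monoʳ-≤ (y ^ p) (bernoulli-lower y (m * T) h₁) ⟩
        y ^ p * (y + m * T) ^ h
      ≡⟨ u₀^h ⟨
        u₀ ^ h
      ≤⟨ ^-monoˡ-≤ h (m≤m+n u₀ w) ⟩
        u ^ h
      ∎
      where
        exponent-sum : ∀ h₁ e → suc (suc h₁ + e) + suc h₁ ≡ 2 + (h₁ + (suc h₁ + e))
        exponent-sum = solve-∀
        exponent-sum′ : ∀ h₁ e → suc (suc h₁ + e) + h₁ ≡ 1 + (h₁ + (suc h₁ + e))
        exponent-sum′ = solve-∀
        y^m : y ^ p * y ^ h ≡ y ^ (2 + k)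
        y^m = trans (sym (^-distribˡ-+-* y p h)) (cong (y ^_) (exponent-sum h₁ e))
        y^m-1 : y ^ p * y ^ h₁ ≡ y ^ (1 + k)
        y^m-1 = trans (sym (^-distribˡ-+-* y p h₁)) (cong (y ^_) (exponent-sum′ h₁ e))
        factor : ∀ a b c m h T → a * b + m * (h * T) * (a * c) ≡ a * (b + h * (m * T) * c)
        factor = solve-∀


    -- Upper bound: by Bernoulli, u^h exceeds u₀^h by at most h w u^(h−1),
    -- which is smaller than the margin h T² y^(h−1) y^(p−1) left by
    -- power-comparison between u₀^h = y^p (y + mT)^h and (y + hT)^m.
    upper : m * T < y → w * 2 ^ h₁ < x → u ^ h < suc (y + D) ^ m
    upper mT<y w<x =
      begin-strict
        u ^ h
      ≤⟨ bernoulli-upper u₀ w h₁ ⟩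
        u₀ ^ h + h * w * u ^ h₁
      <⟨ +-monoʳ-< (u₀ ^ h) correction<margin ⟩
        u₀ ^ h + h * T * T * y ^ h₁ * y ^ (h + e)
      ≡⟨ cong (_+ h * T * T * y ^ h₁ * y ^ (h + e)) u₀^h ⟩
        y ^ p * (y + m * T) ^ h + h * T * T * y ^ h₁ * y ^ (h + e)
      ≤⟨ power-comparison y T h₁ (h + e) 1≤y ⟩
        (y + h * T) ^ m
      ≡⟨ cong (λ z → (y + z) ^ m) hT ⟨
        (y + suc D) ^ m
      ≡⟨ cong (_^ m) (+-suc y D) ⟩
        suc (y + D) ^ m
      ∎
      where
        2^h₁>0 : 1 ≤ 2 ^ h₁
        2^h₁>0 = pos-pow 2 h₁ (s≤s z≤n)
        u≤ : u ≤ x ^ p * (2 * y)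
        u≤ =
          begin
            x ^ p * (y + m * T) + w
          ≤⟨ +-monoʳ-≤ (x ^ p * (y + m * T)) (≤-trans (m≤m*n w (2 ^ h₁) {{>-nonZero 2^h₁>0}}) (≤-trans (<⇒≤ w<x) (base≤power x (h + e)))) ⟩
            x ^ p * (y + m * T) + x ^ p
          ≡⟨ absorb (x ^ p) y (m * T) ⟩
            x ^ p * (y + suc (m * T))
          ≤⟨ *-monoʳ-≤ (x ^ p) (+-monoʳ-≤ y mT<y) ⟩
            x ^ p * (y + y)
          ≡⟨ cong (x ^ p *_) (double y) ⟩
            x ^ p * (2 * y)
          ∎
          where
            absorb : ∀ a y b → a * (y + b) + a ≡ a * (y + suc b)
            absorb = solve-∀
            double : ∀ y → y + y ≡ 2 * y
            double = solve-∀
        X = x ^ (p * h₁)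
        1≤X : 1 ≤ X
        1≤X = pos-pow x (p * h₁) 1≤x
        y^p-1 : y ^ (h + e) ≡ x ^ suc e * X
        y^p-1 = trans (^-*-assoc x h (h + e)) (trans (cong (x ^_) (exponents h₁ e)) (^-distribˡ-+-* x (suc e) (p * h₁)))
          where exponents : ∀ h₁ e → suc h₁ * (suc h₁ + e) ≡ suc e + suc (suc h₁ + e) * h₁
                exponents = solve-∀
        w-small : w * 2 ^ h₁ * X < y ^ (h + e)
        w-small =
          begin-strict
            w * 2 ^ h₁ * X
          <⟨ *-monoˡ-< X {{>-nonZero 1≤X}} w<x ⟩
            x * X
          ≤⟨ *-monoˡ-≤ X (base≤power x e) ⟩
            x ^ suc e * X
          ≡⟨ y^p-1 ⟨
            y ^ (h + e)
          ∎
        correction<margin : h * w * u ^ h₁ < h * T * T * y ^ h₁ * y ^ (h + e)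
        correction<margin =
          begin-strict
            h * w * u ^ h₁
          ≤⟨ *-monoʳ-≤ (h * w) (^-monoˡ-≤ h₁ u≤) ⟩
            h * w * (x ^ p * (2 * y)) ^ h₁
          ≡⟨ cong (h * w *_) (trans (pow-of-product (x ^ p) (2 * y) h₁) (cong₂ _*_ (^-*-assoc x p h₁) (pow-of-product 2 y h₁))) ⟩
            h * w * (X * (2 ^ h₁ * y ^ h₁))
          ≡⟨ regroup h w X (2 ^ h₁) (y ^ h₁) ⟩
            (h * y ^ h₁) * (w * 2 ^ h₁ * X)
          <⟨ *-monoʳ-< (h * y ^ h₁) {{>-nonZero (*-mono-≤ (s≤s (z≤n {h₁})) (pos-pow y h₁ 1≤y))}} w-small ⟩
            (h * y ^ h₁) * y ^ (h + e)
          ≤⟨ *-monoˡ-≤ (y ^ (h + e)) (*-monoˡ-≤ (y ^ h₁) (≤-trans (m≤m*n h (T * T) {{>-nonZero (*-mono-≤ T≥1 T≥1)}}) (≤-reflexive (sym (*-assoc h T T))))) ⟩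
            h * T * T * y ^ h₁ * y ^ (h + e)
          ∎
          where
            T≥1 : 1 ≤ T
            T≥1 = factor-positive D h T hT
            regroup : ∀ h w X t Y → h * w * (X * (t * Y)) ≡ (h * Y) * (w * t * X)
            regroup = solve-∀

    floorPow-u : (1 + k) * D * D * 2 ^ k ≤ y → D ≤ y → m * T < y → w * 2 ^ h₁ < x →
      floorPow u h m ≡ y + D
    floorPow-u big D≤y mT<y w<x = floorPow-spec u h (h₁ + p) (y + D) (lower big D≤y) (upper mT<y w<x)

-- The witness.  Base Q = b + 2, exponents h = h₁ + 1 and m = h + (h + e + 1),
-- target ratio (a + 1)/(d + 1).  All digit blocks below are separated by
-- choosing x = Q^N with N large.
module Construction (b h₁ e a d : ℕ) where
  open import Defs using (floorPow)
  open import Data.Nat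
  open import Data.Nat.Properties
  open import Data.Product using (∃-syntax; _×_; _,_; proj₁; proj₂)
  open import Relation.Binary.PropositionalEquality
  open import Data.Nat.Tactic.RingSolver
  open DigitSums b
  open PowerBounds using (base≤power; pos-pow)

  h p m k : ℕ
  h = suc h₁
  p = suc (h + e)
  m = h + p
  k = h₁ + (h + e)

  -- Leading digits of D: c = h (Q − 1) − 1.  Casting out (Q − 1)s gives
  -- 1 + ds c = (Q − 1) γ for γ = h − j.
  c j γ : ℕ
  c = b + h₁ * suc b
  j = proj₁ (ds-congruence c)
  γ = h ∸ j

  -- L = ds (y + mT);  K and W are tuned so that the ratio comes out right.
  L K W : ℕ
  L = suc (ds (m * suc b))
  K = a * γ + suc a * L
  W = suc b * suc d * (γ + L) ∸ L

  -- T = (Q − 1) Q^K and D = c Q^K + (Q^K − 1), so that D + 1 = hT and D ends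
  -- in K maximal digits; w is a repunit of length W.
  T D w : ℕ
  T = suc b * Q ^ K
  D = c * Q ^ K + maxBlock K
  w = repunit W

  -- Every size condition of the bracketing holds once x = Q^N exceeds Bd.
  X₀ Bd N x y : ℕ
  X₀ = (1 + k) * D * D * 2 ^ k
  Bd = X₀ + D + m * T + 2 ^ h₁
  N = W + Bd
  x = Q ^ N
  y = x ^ h

  D+1≡hT : suc D ≡ h * T
  D+1≡hT = trans (move-suc c (Q ^ K) (maxBlock K)) (trans (cong (c * Q ^ K +_) (maxBlock-value K)) (collect b h₁ (Q ^ K)))
    where
      move-suc : ∀ c X r → suc (c * X + r) ≡ c * X + suc r
      move-suc = solve-∀
      collect : ∀ b h₁ X → (b + h₁ * suc b) * X + X ≡ suc h₁ * (suc b * X)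
      collect = solve-∀

  1≤x : 1 ≤ x
  1≤x = m^n>0 Q N

  Bd<y : Bd < y
  Bd<y = ≤-trans (n<Q^n Bd) (≤-trans (^-monoʳ-≤ Q (m≤n+m Bd W)) (base≤power x h₁))

  second-order<y : X₀ ≤ y
  second-order<y = ≤-trans (≤-trans (m≤m+n X₀ D) (≤-trans (m≤m+n (X₀ + D) (m * T)) (m≤m+n (X₀ + D + m * T) (2 ^ h₁)))) (<⇒≤ Bd<y)

  D<y : D < y
  D<y = ≤-trans (s≤s (≤-trans (m≤n+m D X₀) (≤-trans (m≤m+n (X₀ + D) (m * T)) (m≤m+n (X₀ + D + m * T) (2 ^ h₁))))) Bd<y

  mT<y : m * T < y
  mT<y = ≤-trans (s≤s (≤-trans (m≤n+m (m * T) (X₀ + D)) (m≤m+n (X₀ + D + m * T) (2 ^ h₁)))) Bd<y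

  w·2^h₁<x : w * 2 ^ h₁ < x
  w·2^h₁<x = ≤-trans (*-monoˡ-< (2 ^ h₁) {{>-nonZero (pos-pow 2 h₁ (s≤s z≤n))}} (repunit< W))
               (≤-trans (*-monoʳ-≤ (Q ^ W) (≤-trans (m≤n+m (2 ^ h₁) (X₀ + D + m * T)) (<⇒≤ (n<Q^n Bd))))
                        (≤-reflexive (sym (^-distribˡ-+-* Q W Bd))))

  open Bracket h₁ e x T D w using (u)

  floorPow-u : floorPow u h m ≡ y + D
  floorPow-u = Bracket.floorPow-u h₁ e x T D w 1≤x D+1≡hT second-order<y (<⇒≤ D<y) mT<y w·2^h₁<x

  open ≡-Reasoning

  y≡Q^Nh : y ≡ Q ^ (N * h)
  y≡Q^Nh = ^-*-assoc Q N h

  -- y + D is the digit 1 followed by the digits of c and K maximal digits.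
  ds-floor : ds (y + D) ≡ suc (ds c) + K * suc b
  ds-floor =
    begin
      ds (y + D)
    ≡⟨ cong (λ z → ds (z + D)) y≡Q^Nh ⟩
      ds (Q ^ (N * h) + D)
    ≡⟨ ds-leading-one (N * h) D (subst (D <_) y≡Q^Nh D<y) ⟩
      suc (ds (c * Q ^ K + maxBlock K))
    ≡⟨ cong suc (ds-concat K c (maxBlock K) (≤-reflexive (maxBlock-value K))) ⟩
      suc (ds c + ds (maxBlock K))
    ≡⟨ cong (λ z → suc (ds c + z)) (maxBlock-ds K) ⟩
      suc (ds c) + K * suc b
    ∎

  1+ds-c : suc (ds c) ≡ suc b * γ
  1+ds-c =
    begin
      suc (ds c)
    ≡⟨ m+n∸n≡m (suc (ds c)) (suc b * j) ⟨
      suc (ds c + suc b * j) ∸ suc b * j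
    ≡⟨ cong (λ z → suc z ∸ suc b * j) (proj₂ (ds-congruence c)) ⟩
      h * suc b ∸ suc b * j
    ≡⟨ cong (_∸ suc b * j) (*-comm h (suc b)) ⟩
      suc b * h ∸ suc b * j
    ≡⟨ *-distribˡ-∸ (suc b) h j ⟨
      suc b * γ
    ∎

  -- y + mT is the digit 1 followed by the digits of m(Q − 1), then zeros.
  ds-top : ds (y + m * T) ≡ L
  ds-top =
    begin
      ds (y + m * T)
    ≡⟨ cong (λ z → ds (z + m * T)) y≡Q^Nh ⟩
      ds (Q ^ (N * h) + m * T)
    ≡⟨ ds-leading-one (N * h) (m * T) (subst (m * T <_) y≡Q^Nh mT<y) ⟩
      suc (ds (m * (suc b * Q ^ K)))
    ≡⟨ cong (λ z → suc (ds z)) (*-assoc m (suc b) (Q ^ K)) ⟨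
      suc (ds (m * suc b * Q ^ K))
    ≡⟨ cong suc (ds-shift K (m * suc b)) ⟩
      L
    ∎

  -- u is y + mT shifted by Np digits, followed by the repunit w.
  ds-u : ds u ≡ L + W
  ds-u =
    begin
      ds (x ^ p * (y + m * T) + w)
    ≡⟨ cong (λ z → ds (z + w)) (trans (cong (_* (y + m * T)) x^p≡) (*-comm (Q ^ (N * p)) (y + m * T))) ⟩
      ds ((y + m * T) * Q ^ (N * p) + w)
    ≡⟨ ds-concat (N * p) (y + m * T) w w<Q^Np ⟩
      ds (y + m * T) + ds w
    ≡⟨ cong₂ _+_ ds-top (repunit-ds W) ⟩
      L + W
    ∎
    where
      x^p≡ : x ^ p ≡ Q ^ (N * p)
      x^p≡ = ^-*-assoc Q N p
      w<Q^Np : w < Q ^ (N * p)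
      w<Q^Np = ≤-trans (s≤s (m≤m*n w (2 ^ h₁) {{>-nonZero (pos-pow 2 h₁ (s≤s z≤n))}}))
                 (≤-trans w·2^h₁<x (≤-trans (base≤power x (h + e)) (≤-reflexive x^p≡)))

  L≤ : L ≤ suc b * suc d * (γ + L)
  L≤ = ≤-trans (m≤n+m L γ) (m≤n*m (γ + L) (suc b * suc d))

  ds-u≡ : ds u ≡ suc b * suc d * (γ + L)
  ds-u≡ = trans ds-u (m+[n∸m]≡n L≤)

  -- Both digit sums are multiples of (Q − 1)(γ + L), in the ratio (d+1) : (a+1).
  digit-ratio : suc a * ds u ≡ suc d * ds (y + D)
  digit-ratio =
    begin
      suc a * ds u
    ≡⟨ cong (suc a *_) ds-u≡ ⟩
      suc a * (suc b * suc d * (γ + L))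
    ≡⟨ regroup a d b γ L ⟩
      suc d * (suc b * γ + K * suc b)
    ≡⟨ cong (λ z → suc d * (z + K * suc b)) 1+ds-c ⟨
      suc d * (suc (ds c) + K * suc b)
    ≡⟨ cong (suc d *_) ds-floor ⟨
      suc d * ds (y + D)
    ∎
    where
      regroup : ∀ a d b γ L → suc a * (suc b * suc d * (γ + L)) ≡ suc d * (suc b * γ + (a * γ + suc a * L) * suc b)
      regroup = solve-∀

  witness : ∃[ u ] (1 ≤ ds u × suc a * ds u ≡ suc d * ds (floorPow u h m))
  witness = u , subst (1 ≤_) (sym ds-u≡) (≤-trans (s≤s z≤n) L≤)
              , subst (λ v → suc a * ds u ≡ suc d * ds v) (sym floorPow-u) digit-ratio

module AnyExponent where
  open import Defs using (floorPow)
  open import Data.Nat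
  open import Data.Nat.Properties using (m≤n⇒∃[o]m+o≡n)
  open import Data.Product using (∃-syntax; _×_; _,_)
  open import Relation.Binary.PropositionalEquality
  open import Data.Nat.Tactic.RingSolver
  open DigitSums using (ds)

  witness : ∀ b h₁ m → 2 * suc h₁ < m → ∀ a d →
    ∃[ u ] (1 ≤ ds b u × suc a * ds b u ≡ suc d * ds b (floorPow u (suc h₁) m))
  witness b h₁ m 2h<m a d with m≤n⇒∃[o]m+o≡n 2h<m
  ... | e , refl = subst (λ m → ∃[ u ] (1 ≤ ds b u × suc a * ds b u ≡ suc d * ds b (floorPow u (suc h₁) m)))
                         (exponent h₁ e) (Construction.witness b h₁ e a d)
    where
      exponent : ∀ h₁ e → suc h₁ + suc (suc h₁ + e) ≡ suc (2 * suc h₁) + e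
      exponent = solve-∀

module Rationals where
  open import Data.Nat as ℕ using (ℕ; suc; zero)
  open import Data.Integer as ℤ using (+_; +[1+_]; -[1+_])
  open import Data.Integer.Properties using (pos-*)
  open import Data.Rational using (ℚ; 0ℚ; mkℚ)
  open import Data.Rational.Base using (_<_; _*_; _/_; *<*; toℚᵘ)
  open import Data.Rational.Properties using (toℚᵘ-injective; toℚᵘ-homo-*; toℚᵘ-fromℚᵘ)
  import Data.Rational.Unnormalised.Base as U
  import Data.Rational.Unnormalised.Properties as UP
  import Data.Nat.Properties as ℕP
  open import Data.Product using (∃; _,_)
  open import Relation.Binary.PropositionalEquality

  positive-numerator : ∀ (r : ℚ) → 0ℚ < r → ∃ λ a → ℚ.numerator r ≡ + suc a
  positive-numerator (mkℚ (+ zero) _ _) (*<* (ℤ.+<+ ()))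
  positive-numerator (mkℚ +[1+ n ] _ _) _ = n , refl
  positive-numerator (mkℚ -[1+ n ] _ _) (*<* ())

  -- The cross-multiplied form of (a/den) · (U/1) = V/1.
  cross-multiplied : ∀ a U V den → a ℕ.* U ≡ den ℕ.* V → (+ a ℤ.* + U) ℤ.* + 1 ≡ + V ℤ.* + (den ℕ.* 1)
  cross-multiplied a U V den eq rewrite sym (pos-* a U) | sym (pos-* (a ℕ.* U) 1) | sym (pos-* V (den ℕ.* 1)) =
    cong +_ (trans (ℕP.*-identityʳ (a ℕ.* U)) (trans eq (trans (ℕP.*-comm den V) (cong (V ℕ.*_) (sym (ℕP.*-identityʳ den))))))

  scale-integer : ∀ (r : ℚ) a (U V : ℕ) → ℚ.numerator r ≡ + a → a ℕ.* U ≡ suc (ℚ.denominator-1 r) ℕ.* V →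
    r * ((+ U) / 1) ≡ (+ V) / 1
  scale-integer r@(mkℚ _ d _) a U V refl eq = toℚᵘ-injective
    (UP.≃-trans (toℚᵘ-homo-* r ((+ U) / 1))
    (UP.≃-trans (UP.*-congˡ {toℚᵘ r} (toℚᵘ-fromℚᵘ (U.mkℚᵘ (+ U) 0)))
    (UP.≃-trans (U.*≡* (cross-multiplied a U V (suc d) eq)) (UP.≃-sym (toℚᵘ-fromℚᵘ (U.mkℚᵘ (+ V) 0))))))

open import Defs
open import Data.Nat using (ℕ; _≤_; _<_; _*_)
open import Data.Nat.GCD using (gcd)
open import Data.Product using (∃-syntax; _×_)
open import Data.Rational using (ℚ; 0ℚ)
open import Data.Rational.Base using (_<_; _*_)
open import Data.Integer using (+_)
open import Relation.Binary.PropositionalEquality using (_≡_)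
open import Data.Nat using (zero; suc; s≤s)
open import Data.Product using (_,_)

theorem4p1 : (r : ℚ) → 0ℚ Data.Rational.Base.< r →
    (q h m : ℕ) → 2 ≤ q → 1 ≤ h → 3 ≤ m → gcd h m ≡ 1 → 2 Data.Nat.* h Data.Nat.< m →
    ∃[ u ] (1 ≤ s q u × r Data.Rational.Base.* Data.Rational.Base._/_ (+ s q u) 1 ≡ Data.Rational.Base._/_ (+ s q (floorPow u h m)) 1)
theorem4p1 r 0<r (suc zero) h m (s≤s ()) _ _ _ _
theorem4p1 r 0<r (suc (suc b)) (suc h₁) m _ _ _ _ 2h<m
  with Rationals.positive-numerator r 0<r
... | a , numerator≡ with AnyExponent.witness b h₁ m 2h<m a (ℚ.denominator-1 r)
... | u , positive , ratio = u , positive , Rationals.scale-integer r (suc a) _ _ numerator≡ ratio
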